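{- Let $\mathcal{R}$ be an rc-poset with rows labeled $1,\dots,n$ and columns labeled $1,\dots,k$. For every $\omega\in\mathfrak{S}_n$ and every $\nu\in\mathfrak{S}_k$ there is a bijection $\Phi:J(\mathcal{R})\to J(\mathcal{R})$ with $\Phi\circ\mathrm{pro}_\nu=\mathrm{row}_\omega\circ\Phi$.
   Context: Let $\Pi=\{(i,j)\in\mathbb{Z}^2 : i\equiv j\pmod 2\}$. An rc-poset is a finite poset $\mathcal{R}$ with a map $\pi:\mathcal{R}\to\Pi$ such that whenever $p_1$ covers $p_2$ and $\pi(p_1)=(i,j)$, then $\pi(p_2)\in\{(i+1,j-1),(i-1,j-1)\}$ (several elements may share a position). The column of $p$ is the first coordinate of $\pi(p)$ and its row the second; the occurring columns lie in $k$ consecutive integers relabeled $1,\dots,k$ in increasing order, and the occurring rows in $n$ consecutive integers relabeled $1,\dots,n$. $J(\mathcal{R})$ is the set of order ideals of $\mathcal{R}$. For $p\in\mathcal{R}$ the toggle $t_p:J(\mathcal{R})\to J(\mathcal{R})$ is: $t_p(I)=I\cup\{p\}$ if $p\notin I$ and all $p'<p$ lie in $I$; $t_p(I)=I\setminus\{p\}$ if $p\in I$ and no $p'>p$ lies in $I$; $t_p(I)=I$ otherwise. Toggles of elements in a common row (or common column) commute, so $r_j=\prod_{p\text{ in row }j}t_p$ and $c_i=\prod_{p\text{ in column }i}t_p$ are well defined. For $\nu\in\mathfrak{S}_k$, $\mathrm{pro}_\nu=c_{\nu(1)}\circ c_{\nu(2)}\circ\cdots\circ c_{\nu(k)}$,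 and for $\omega\in\mathfrak{S}_n$, $\mathrm{row}_\omega=r_{\omega(1)}\circ\cdots\circ r_{\omega(n)}$. -}

module Defs where

open import Level using (0ℓ)
open import Data.Nat using (ℕ)
open import Data.Bool using (Bool; true; false; if_then_else_)
open import Data.Fin using (Fin; toℕ; _≟_)
open import Data.Fin.Properties using (all?; any?)
open import Data.Fin.Permutation using (Permutation′; _⟨$⟩ʳ_)
open import Data.Integer as ℤ using (ℤ; +_)
open import Data.Integer.Divisibility using (_∣_)
open import Data.List using (List; foldr; allFin)
open import Data.Product using (_×_; _,_; proj₁; proj₂; ∃)
open import Data.Sum using (_⊎_)
open import Function using (_∘_; id)
open import Relation.Binary using (IsDecPartialOrder)
open import Relation.Binary.PropositionalEquality using (_≡_; _≢_)
open import Relation.Nullary using (¬_; Dec; yes; no; does)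
open import Relation.Nullary.Decidable using (_→-dec_; _×-dec_; ¬?)
open import Data.Bool.Properties renaming (_≟_ to _≟B_)

InΠ : ℤ × ℤ → Set
InΠ (i , j) = (+ 2) ∣ (i ℤ.- j)

module _ {m : ℕ} (_≼_ : Fin m → Fin m → Set) where
  Strict : Fin m → Fin m → Set
  Strict q p = (q ≼ p) × (q ≢ p)

  Covers : Fin m → Fin m → Set
  Covers p₁ p₂ = Strict p₂ p₁ × (∀ q → ¬ (Strict p₂ q × Strict q p₁))

-- An rc-poset on the finite carrier Fin m (elements p : Fin m), whose
-- columns lie in the k consecutive integers colBase, …, colBase + k - 1
-- (relabeled 1,…,k ; in Agda the label i ∈ {1..k} is the index i-1 : Fin k),
-- and whose rows lie in rowBase, …, rowBase + n - 1 (relabeled 1,…,n).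
record RCPoset (m n k : ℕ) : Set₁ where
  field
    _≼_   : Fin m → Fin m → Set
    isDecPartialOrder : IsDecPartialOrder _≡_ _≼_
    π     : Fin m → ℤ × ℤ
    π∈Π   : ∀ p → InΠ (π p)
    colBase rowBase : ℤ
    colRange : ∀ p → (colBase ℤ.≤ proj₁ (π p)) × (proj₁ (π p) ℤ.< colBase ℤ.+ + k)
    rowRange : ∀ p → (rowBase ℤ.≤ proj₂ (π p)) × (proj₂ (π p) ℤ.< rowBase ℤ.+ + n)
    coverStep : ∀ p₁ p₂ → Covers _≼_ p₁ p₂ →
      (π p₂ ≡ (proj₁ (π p₁) ℤ.+ + 1 , proj₂ (π p₁) ℤ.- + 1))
        ⊎ (π p₂ ≡ (proj₁ (π p₁) ℤ.- + 1 , proj₂ (π p₁) ℤ.- + 1))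

  open IsDecPartialOrder isDecPartialOrder using () renaming (_≤?_ to _≼?_)

  col row : Fin m → ℤ
  col p = proj₁ (π p)
  row p = proj₂ (π p)

  _≺_ : Fin m → Fin m → Set
  _≺_ = Strict _≼_

  _≺?_ : ∀ q p → Dec (q ≺ p)
  q ≺? p = (q ≼? p) ×-dec ¬? (q ≟ p)

  Subset : Set
  Subset = Fin m → Bool

  _∈_ : Fin m → Subset → Set
  p ∈ I = I p ≡ true

  IsIdeal : Subset → Set
  IsIdeal I = ∀ p q → q ≼ p → p ∈ I → q ∈ I

  update : Subset → Fin m → Bool → Subset
  update I p b q = if does (q ≟ p) then b else I q

  toggle : Fin m → Subset → Subset
  toggle p I with I p
  ... | false = if does (all? (λ q → (q ≺? p) →-dec (I q ≟B true)))
                  then update I p true else I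
  ... | true  = if does (any? (λ q → (p ≺? q) ×-dec (I q ≟B true)))
                  then I else update I p false

  toggleAll : (Fin m → Bool) → Subset → Subset
  toggleAll sel = foldr (λ p f → if sel p then toggle p ∘ f else f) id (allFin m)

  c : Fin k → Subset → Subset
  c i = toggleAll (λ p → does (ℤ._≟_ (col p) (colBase ℤ.+ + toℕ i)))

  r : Fin n → Subset → Subset
  r j = toggleAll (λ p → does (ℤ._≟_ (row p) (rowBase ℤ.+ + toℕ j)))

  pro : Permutation′ k → Subset → Subset
  pro ν = foldr (λ i f → c (ν ⟨$⟩ʳ i) ∘ f) id (allFin k)

  rowmotion : Permutation′ n → Subset → Subset
  rowmotion ω = foldr (λ j f → r (ω ⟨$⟩ʳ j) ∘ f) id (allFin n)

  IsBijectionOnJ : (Subset → Subset) → Set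
  IsBijectionOnJ Φ =
    (∀ I → IsIdeal I → IsIdeal (Φ I))
    × (∀ I I′ → IsIdeal I → IsIdeal I′ → (∀ p → Φ I p ≡ Φ I′ p) → ∀ p → I p ≡ I′ p)
    × (∀ I′ → IsIdeal I′ → ∃ λ I → IsIdeal I × (∀ p → Φ I p ≡ I′ p))

-- Toggles are involutions on J(R), and toggles of two elements commute unless one
-- covers the other. Covers change the column and the row by exactly one, so the column
-- toggles c_i behave like the generators of a Coxeter group of type A: c_i and c_i′
-- commute unless |i − i′| = 1. As in such a group, all products of the c_i in some
-- order are conjugate, so pro_ν is conjugate in the toggle group to "all odd columns,
-- then all even columns", and likewise row_ω to "all odd rows, then all even rows".
-- Since column ≡ row (mod 2), the elements in even columns are exactly those in even
-- rows or exactly those in odd rows, so these two products are equal or rotations of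
-- each other, hence conjugate. Conjugation by the resulting word of toggles is the
-- bijection Φ.
module Submission where

open import Defs
open import Level using (0ℓ)
open import Data.Bool using (true; false; if_then_else_)
open import Data.Bool.Properties using () renaming (_≟_ to _≟B_)
open import Data.Empty using (⊥-elim)
open import Data.Product using (_×_; _,_; proj₁; proj₂; ∃)
open import Data.Sum using (_⊎_; inj₁; inj₂)
open import Data.Nat as ℕ using (ℕ; zero; suc; parity)
import Data.Nat.Properties as ℕP
open import Data.Nat.Divisibility using (divides)
open import Data.Parity as ℙ using (Parity; 0ℙ; 1ℙ)
import Data.Parity.Properties as ℙP
open import Data.Integer as ℤ using (ℤ; +_; -[1+_]; _⊖_; ∣_∣)
open import Data.Integer.Divisibility using (_∣_)
import Data.Integer.Properties as ℤP
open import Data.Integer.Tactic.RingSolver using (solve-∀)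
open import Data.Fin using (Fin; _≟_; toℕ; fromℕ<)
open import Data.Fin.Properties using (all?; any?)
import Data.Fin.Properties as FinP
open import Data.Fin.Permutation as Perm using (Permutation′; _⟨$⟩ʳ_; _⟨$⟩ˡ_)
open import Data.List
  using (List; []; _∷_; _++_; reverse; [_]; filter; map; allFin; concatMap; foldr)
open import Data.List.Properties
  using ( ++-assoc; ++-identityʳ; unfold-reverse; reverse-involutive
        ; concatMap-++; concatMap-map; filter-none; filter-≐)
open import Data.List.Membership.Propositional using (_∈_; _∉_; find; lose)
open import Data.List.Membership.Propositional.Properties
  using (∈-++⁺ˡ; ∈-++⁺ʳ; ∈-++⁻; ∈-filter⁻; ∈-map⁺; ∈-map⁻; ∈-allFin; ∈-∃++)
open import Data.List.Relation.Unary.Any as Any using (here; there)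
import Data.List.Relation.Unary.Any.Properties as AnyP
open import Data.List.Relation.Unary.All as All using (All)
import Data.List.Relation.Unary.All.Properties as AllP
open import Data.List.Relation.Unary.AllPairs using (_∷_)
open import Data.List.Relation.Unary.Unique.Propositional using (Unique)
import Data.List.Relation.Unary.Unique.Propositional.Properties as UniqueP
open import Data.List.Relation.Binary.Subset.Propositional using (_⊆_)
open import Data.List.Relation.Binary.Subset.Propositional.Properties using (⊆-refl; xs⊆ys++xs)
open import Function using (_∘_; _$_; id; _⇔_; mk⇔; Equivalence)
open import Relation.Binary.Bundles using (Setoid)
import Relation.Binary.Reasoning.Setoid as SetoidReasoning
open import Relation.Binary.PropositionalEquality hiding ([_])
open import Relation.Nullary using (¬_; Dec; yes; no; does)
open import Relation.Nullary.Decidable using (_→-dec_; _×-dec_; does-⇔; dec-true; dec-false)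
open import Relation.Unary using (Pred; Decidable; _∪_) renaming (_⊆_ to _⊆₁_)
open import Relation.Unary.Properties using (_∪?_)

-- Adjacency, parity and integer offsets

Adjacent : ℕ → ℕ → Set
Adjacent a b = a ≡ suc b ⊎ b ≡ suc a

Adjacent-sym : ∀ {a b} → Adjacent a b → Adjacent b a
Adjacent-sym (inj₁ a≡1+b) = inj₂ a≡1+b
Adjacent-sym (inj₂ b≡1+a) = inj₁ b≡1+a

<-¬Adjacent : ∀ {a b} → suc a ℕ.< b → ¬ Adjacent a b
<-¬Adjacent 1+a<b (inj₁ refl) = ℕP.<-asym 1+a<b (ℕP.m<n⇒m<1+n (ℕP.n<1+n _))
<-¬Adjacent 1+a<b (inj₂ refl) = ℕP.<-irrefl refl 1+a<b

parity-suc-≢ : ∀ n → parity (suc n) ≢ parity n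
parity-suc-≢ n eq = ℙP.p≢p⁻¹ (parity (suc n)) (trans eq (sym (ℙP.suc-homo-⁻¹ n)))

parity-suc-+-suc : ∀ m n → parity (suc m) ℙ.+ parity (suc n) ≡ parity m ℙ.+ parity n
parity-suc-+-suc m n = begin
  parity (suc m) ℙ.+ parity (suc n)  ≡⟨ ℙP.+-homo-+ (suc m) (suc n) ⟨
  parity (suc (m ℕ.+ suc n))         ≡⟨ cong (parity ∘ suc) (ℕP.+-suc m n) ⟩
  parity (m ℕ.+ n)                   ≡⟨ ℙP.+-homo-+ m n ⟩
  parity m ℙ.+ parity n              ∎
  where open ≡-Reasoning

parityℤ : ℤ → Parity
parityℤ i = parity ∣ i ∣

parityℤ-⊖ : ∀ m n → parityℤ (m ⊖ n) ≡ parity m ℙ.+ parity n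
parityℤ-⊖ m zero = sym (ℙP.+-identityʳ (parity m))
parityℤ-⊖ zero (suc n) = refl
parityℤ-⊖ (suc m) (suc n) = begin
  parityℤ (suc m ⊖ suc n)            ≡⟨ cong parityℤ (ℤP.[1+m]⊖[1+n]≡m⊖n m n) ⟩
  parityℤ (m ⊖ n)                    ≡⟨ parityℤ-⊖ m n ⟩
  parity m ℙ.+ parity n              ≡⟨ parity-suc-+-suc m n ⟨
  parity (suc m) ℙ.+ parity (suc n)  ∎
  where open ≡-Reasoning

parityℤ-+ : ∀ i j → parityℤ (i ℤ.+ j) ≡ parityℤ i ℙ.+ parityℤ j
parityℤ-+ (+ m) (+ n) = ℙP.+-homo-+ m n
parityℤ-+ (+ m) -[1+ n ] = parityℤ-⊖ m (suc n)
parityℤ-+ -[1+ m ] (+ n) = trans (parityℤ-⊖ n (suc m)) (ℙP.+-comm (parity n) (parity (suc m)))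
parityℤ-+ -[1+ m ] -[1+ n ] = trans (ℙP.+-homo-+ m n) (sym (parity-suc-+-suc m n))

parityℤ-even : ∀ {i} → + 2 ∣ i → parityℤ i ≡ 0ℙ
parityℤ-even (divides q ∣i∣≡q*2) =
  trans (cong parity ∣i∣≡q*2) (trans (ℙP.*-homo-* q 2) (ℙP.*-zeroʳ (parity q)))

+-cancel-twice : ∀ x β → (x ℙ.+ β) ℙ.+ β ≡ x
+-cancel-twice x β = begin
  (x ℙ.+ β) ℙ.+ β  ≡⟨ ℙP.+-assoc x β β ⟩
  x ℙ.+ (β ℙ.+ β)  ≡⟨ cong (x ℙ.+_) (ℙP.p+p≡0ℙ β) ⟩
  x ℙ.+ 0ℙ         ≡⟨ ℙP.+-identityʳ x ⟩
  x                ∎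
  where open ≡-Reasoning

neg-+-cancelˡ : ∀ b x → ℤ.- b ℤ.+ (b ℤ.+ x) ≡ x
neg-+-cancelˡ = solve-∀

ℤ+-cancelˡ : ∀ b {x y} → b ℤ.+ x ≡ b ℤ.+ y → x ≡ y
ℤ+-cancelˡ b {x} {y} eq = begin
  x                      ≡⟨ neg-+-cancelˡ b x ⟨
  ℤ.- b ℤ.+ (b ℤ.+ x)    ≡⟨ cong (λ i → ℤ.- b ℤ.+ i) eq ⟩
  ℤ.- b ℤ.+ (b ℤ.+ y)    ≡⟨ neg-+-cancelˡ b y ⟩
  y                      ∎
  where open ≡-Reasoning

offset-≡ : ∀ {b i} → b ℤ.≤ i → b ℤ.+ + ∣ i ℤ.- b ∣ ≡ i
offset-≡ {b} {i} b≤i =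
  trans (cong (λ j → b ℤ.+ j) (ℤP.0≤i⇒+∣i∣≡i (ℤP.i≤j⇒0≤j-i b≤i))) (+-minus-cancel b i)
  where
  +-minus-cancel : ∀ b i → b ℤ.+ (i ℤ.- b) ≡ i
  +-minus-cancel = solve-∀

offset-< : ∀ b {x K} → b ℤ.+ + x ℤ.< b ℤ.+ + K → x ℕ.< K
offset-< b {x} {K} lt =
  ℤP.drop‿+<+ (subst₂ ℤ._<_ (neg-+-cancelˡ b (+ x)) (neg-+-cancelˡ b (+ K))
                        (ℤP.+-monoʳ-< (ℤ.- b) lt))

offset-suc : ∀ b {x y} → b ℤ.+ + y ≡ (b ℤ.+ + x) ℤ.+ ℤ.1ℤ → y ≡ suc x
offset-suc b {x} {y} eq =
  trans (ℤP.+-injective (ℤ+-cancelˡ b (trans eq (ℤP.+-assoc b (+ x) ℤ.1ℤ)))) (ℕP.+-comm x 1)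

offset-pred : ∀ b {x y} → b ℤ.+ + y ≡ (b ℤ.+ + x) ℤ.- ℤ.1ℤ → x ≡ suc y
offset-pred b {x} {y} eq =
  offset-suc b (trans (sym (minus-plus (b ℤ.+ + x) ℤ.1ℤ)) (cong (ℤ._+ ℤ.1ℤ) (sym eq)))
  where
  minus-plus : ∀ i j → (i ℤ.- j) ℤ.+ j ≡ i
  minus-plus = solve-∀

Enumerates : ℕ → List ℕ → Set
Enumerates j L = Unique L × (∀ a → a ∈ L ⇔ a ℕ.< j)

Unique-++ʳ : ∀ {X : Set} (A : List X) {B} → Unique (A ++ B) → Unique B
Unique-++ʳ [] u = u
Unique-++ʳ (a ∷ A) (_ ∷ u) = Unique-++ʳ A u

Unique-++-disjoint : ∀ {X : Set} (A : List X) {B} → Unique (A ++ B) → ∀ {a} → a ∈ A → a ∉ B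
Unique-++-disjoint (a ∷ A) (a≢ ∷ u) (here refl) a∈B = All.lookup a≢ (∈-++⁺ʳ A a∈B) refl
Unique-++-disjoint (_ ∷ A) (_ ∷ u) (there a∈A) = Unique-++-disjoint A u a∈A

Unique-dropMiddle : ∀ {X : Set} (A : List X) {x B} → Unique (A ++ x ∷ B) → Unique (A ++ B)
Unique-dropMiddle [] (_ ∷ u) = u
Unique-dropMiddle (a ∷ A) (a≢ ∷ u) with a≢A , _ All.∷ a≢B ← AllP.++⁻ A a≢ =
  AllP.++⁺ a≢A a≢B ∷ Unique-dropMiddle A u

Unique-middle-∉ : ∀ {X : Set} (A : List X) {x B} → Unique (A ++ x ∷ B) → x ∉ A ++ B
Unique-middle-∉ A u x∈ with ∈-++⁻ A x∈
... | inj₁ x∈A = Unique-++-disjoint A u x∈A (here refl)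
... | inj₂ x∈B = UniqueP.Unique[x∷xs]⇒x∉xs (Unique-++ʳ A u) x∈B

Enumerates-dropMiddle : ∀ j A B → Enumerates (suc j) (A ++ j ∷ B) → Enumerates j (A ++ B)
Enumerates-dropMiddle j A B (u , ∈⇔<) = Unique-dropMiddle A u , λ a → mk⇔ (to a) (from a)
  where
  to : ∀ a → a ∈ A ++ B → a ℕ.< j
  to a a∈ = ℕP.≤∧≢⇒< (ℕ.s≤s⁻¹ (Equivalence.to (∈⇔< a) (widen a∈)))
                     λ { refl → Unique-middle-∉ A u a∈ }
    where
    widen : a ∈ A ++ B → a ∈ A ++ j ∷ B
    widen a∈ with ∈-++⁻ A a∈
    ... | inj₁ a∈A = ∈-++⁺ˡ a∈A
    ... | inj₂ a∈B = ∈-++⁺ʳ A (there a∈B)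
  from : ∀ a → a ℕ.< j → a ∈ A ++ B
  from a a<j with ∈-++⁻ A (Equivalence.from (∈⇔< a) (ℕP.m<n⇒m<1+n a<j))
  ... | inj₁ a∈A = ∈-++⁺ˡ a∈A
  ... | inj₂ (here refl) = ⊥-elim (ℕP.<-irrefl refl a<j)
  ... | inj₂ (there a∈B) = ∈-++⁺ʳ A a∈B

oneLine : ∀ {k} → Permutation′ k → List ℕ
oneLine {k} ν = map (λ i → toℕ (ν ⟨$⟩ʳ i)) (allFin k)

oneLine-enumerates : ∀ {k} (ν : Permutation′ k) → Enumerates k (oneLine ν)
oneLine-enumerates {k} ν = UniqueP.map⁺ injective (UniqueP.allFin⁺ k) , λ a → mk⇔ (to a) (from a)
  where
  injective : ∀ {i i′} → toℕ (ν ⟨$⟩ʳ i) ≡ toℕ (ν ⟨$⟩ʳ i′) → i ≡ i′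
  injective eq = trans (sym (Perm.inverseˡ ν))
                       (trans (cong (ν ⟨$⟩ˡ_) (FinP.toℕ-injective eq)) (Perm.inverseˡ ν))
  to : ∀ a → a ∈ oneLine ν → a ℕ.< k
  to a a∈ with i , _ , refl ← ∈-map⁻ (λ i → toℕ (ν ⟨$⟩ʳ i)) a∈ = FinP.toℕ<n (ν ⟨$⟩ʳ i)
  from : ∀ a → a ℕ.< k → a ∈ oneLine ν
  from a a<k = subst (_∈ oneLine ν) (trans (cong toℕ (Perm.inverseʳ ν)) (FinP.toℕ-fromℕ< a<k))
                 (∈-map⁺ (λ i → toℕ (ν ⟨$⟩ʳ i)) (∈-allFin (ν ⟨$⟩ˡ fromℕ< a<k)))

module ToggleGroup {m n k : ℕ} (R : RCPoset m n k) where
  open RCPoset R hiding (_∈_)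

  -- Toggles on order ideals

  AllBelow SomeAbove : Fin m → Subset → Set
  AllBelow p I = ∀ q → q ≺ p → I q ≡ true
  SomeAbove p I = ∃ λ q → p ≺ q × I q ≡ true

  allBelow? : ∀ p I → Dec (AllBelow p I)
  allBelow? p I = all? (λ q → (q ≺? p) →-dec (I q ≟B true))

  someAbove? : ∀ p I → Dec (SomeAbove p I)
  someAbove? p I = any? (λ q → (p ≺? q) ×-dec (I q ≟B true))

  update-≢ : ∀ I p b {q} → q ≢ p → update I p b q ≡ I q
  update-≢ I p b {q} q≢p with q ≟ p
  ... | yes q≡p = ⊥-elim (q≢p q≡p)
  ... | no _ = refl

  update-self : ∀ I p b → update I p b p ≡ b
  update-self I p b with p ≟ p
  ... | yes _ = refl
  ... | no p≢p = ⊥-elim (p≢p refl)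

  ∈-or-∉ : ∀ (I : Subset) q → I q ≡ true ⊎ I q ≡ false
  ∈-or-∉ I q with I q
  ... | true = inj₁ refl
  ... | false = inj₂ refl

  if-does-app : ∀ {A : Set} (d : Dec A) {f g : Subset} {q} {b} →
    (A → f q ≡ b) → (¬ A → g q ≡ b) → (if does d then f else g) q ≡ b
  if-does-app (yes a) onYes onNo = onYes a
  if-does-app (no ¬a) onYes onNo = onNo ¬a

  toggle-≢ : ∀ p I {q} → q ≢ p → toggle p I q ≡ I q
  toggle-≢ p I q≢p with I p
  ... | false = if-does-app (allBelow? p I) (λ _ → update-≢ I p true q≢p) (λ _ → refl)
  ... | true = if-does-app (someAbove? p I) (λ _ → refl) (λ _ → update-≢ I p false q≢p)

  toggle-self : ∀ p I →
    toggle p I p ≡ (if I p then does (someAbove? p I) else does (allBelow? p I))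
  toggle-self p I with I p in eq
  ... | false = if-does-app (allBelow? p I) {b = does (allBelow? p I)}
                  (λ ab → trans (update-self I p true) (sym (dec-true (allBelow? p I) ab)))
                  (λ ¬ab → trans eq (sym (dec-false (allBelow? p I) ¬ab)))
  ... | true = if-does-app (someAbove? p I) {b = does (someAbove? p I)}
                 (λ sa → trans eq (sym (dec-true (someAbove? p I) sa)))
                 (λ ¬sa → trans (update-self I p false) (sym (dec-false (someAbove? p I) ¬sa)))

  toggle-adds : ∀ {p I} → I p ≡ false → AllBelow p I → toggle p I p ≡ true
  toggle-adds {p} {I} p∉I ab rewrite toggle-self p I | p∉I = dec-true (allBelow? p I) ab

  toggle-keeps-out : ∀ {p I} → I p ≡ false → ¬ AllBelow p I → toggle p I p ≡ false
  toggle-keeps-out {p} {I} p∉I ¬ab rewrite toggle-self p I | p∉I = dec-false (allBelow? p I) ¬ab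

  toggle-keeps : ∀ {p I} → I p ≡ true → SomeAbove p I → toggle p I p ≡ true
  toggle-keeps {p} {I} p∈I sa rewrite toggle-self p I | p∈I = dec-true (someAbove? p I) sa

  toggle-removes : ∀ {p I} → I p ≡ true → ¬ SomeAbove p I → toggle p I p ≡ false
  toggle-removes {p} {I} p∈I ¬sa rewrite toggle-self p I | p∈I = dec-false (someAbove? p I) ¬sa

  toggle-self-cong : ∀ p {I J} → I p ≡ J p →
    AllBelow p I ⇔ AllBelow p J → SomeAbove p I ⇔ SomeAbove p J → toggle p I p ≡ toggle p J p
  toggle-self-cong p {I} {J} p∈I≡p∈J ab⇔ sa⇔ = begin
    toggle p I p
      ≡⟨ toggle-self p I ⟩
    (if I p then does (someAbove? p I) else does (allBelow? p I))
      ≡⟨ cong (if_then _ else _) p∈I≡p∈J ⟩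
    (if J p then does (someAbove? p I) else does (allBelow? p I))
      ≡⟨ cong₂ (if_then_else_ (J p)) (does-⇔ sa⇔ (someAbove? p I) (someAbove? p J))
                                  (does-⇔ ab⇔ (allBelow? p I) (allBelow? p J)) ⟩
    (if J p then does (someAbove? p J) else does (allBelow? p J))
      ≡⟨ toggle-self p J ⟨
    toggle p J p ∎
    where open ≡-Reasoning

  allBelow-⇔ : ∀ {p I J} → (∀ x → x ≺ p → I x ≡ J x) → AllBelow p I ⇔ AllBelow p J
  allBelow-⇔ I≡J = mk⇔ (λ ab x x≺p → trans (sym (I≡J x x≺p)) (ab x x≺p))
                       (λ ab x x≺p → trans (I≡J x x≺p) (ab x x≺p))

  someAbove-⇔ : ∀ {p I J} → (∀ x → p ≺ x → I x ≡ J x) → SomeAbove p I ⇔ SomeAbove p J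
  someAbove-⇔ I≡J = mk⇔ (λ (x , p≺x , x∈I) → x , p≺x , trans (sym (I≡J x p≺x)) x∈I)
                        (λ (x , p≺x , x∈J) → x , p≺x , trans (I≡J x p≺x) x∈J)

  ideal-≺ : ∀ {I} → IsIdeal I → ∀ {x y} → x ≺ y → I y ≡ true → I x ≡ true
  ideal-≺ ideal {x} {y} x≺y = ideal y x (proj₁ x≺y)

  ≺⇒≢ : ∀ {x y} → x ≺ y → x ≢ y
  ≺⇒≢ = proj₂

  toggle-cong : ∀ p {I J} → I ≗ J → toggle p I ≗ toggle p J
  toggle-cong p {I} {J} I≗J q with q ≟ p
  ... | no q≢p = trans (toggle-≢ p I q≢p) (trans (I≗J q) (sym (toggle-≢ p J q≢p)))
  ... | yes refl = toggle-self-cong q (I≗J q) (allBelow-⇔ (λ x _ → I≗J x))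
                                               (someAbove-⇔ (λ x _ → I≗J x))

  toggle-ideal : ∀ p {I} → IsIdeal I → IsIdeal (toggle p I)
  toggle-ideal p {I} ideal a b b≼a a∈ with a ≟ p | b ≟ p
  ... | yes refl | yes refl = a∈
  ... | no a≢p | no b≢p =
    trans (toggle-≢ p I b≢p) (ideal a b b≼a (trans (sym (toggle-≢ p I a≢p)) a∈))
  ... | yes refl | no b≢a = trans (toggle-≢ a I b≢a) b∈I
    where
    b∈I : I b ≡ true
    b∈I with ∈-or-∉ I a | allBelow? a I
    ... | inj₁ a∈I | _ = ideal a b b≼a a∈I
    ... | inj₂ _ | yes ab = ab b (b≼a , b≢a)
    ... | inj₂ a∉I | no ¬ab with () ← trans (sym a∈) (toggle-keeps-out a∉I ¬ab)
  ... | no a≢b | yes refl = toggle-keeps (ideal a b b≼a a∈I) (a , (b≼a , a≢b ∘ sym) , a∈I)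
    where
    a∈I : I a ≡ true
    a∈I = trans (sym (toggle-≢ b I a≢b)) a∈

  allBelow-toggle-self : ∀ p I → AllBelow p (toggle p I) ⇔ AllBelow p I
  allBelow-toggle-self p I = allBelow-⇔ (λ x x≺p → toggle-≢ p I (≺⇒≢ x≺p))

  someAbove-toggle-self : ∀ p I → SomeAbove p (toggle p I) ⇔ SomeAbove p I
  someAbove-toggle-self p I = someAbove-⇔ (λ x p≺x → toggle-≢ p I (≺⇒≢ p≺x ∘ sym))

  toggle-involutive : ∀ p {I} → IsIdeal I → toggle p (toggle p I) ≗ I
  toggle-involutive p {I} ideal q with q ≟ p
  ... | no q≢p = trans (toggle-≢ p (toggle p I) q≢p) (toggle-≢ p I q≢p)
  ... | yes refl with ∈-or-∉ I q
  ...   | inj₁ q∈I with someAbove? q I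
  ...     | yes sa = trans (toggle-keeps (toggle-keeps q∈I sa)
                                         (Equivalence.from (someAbove-toggle-self q I) sa)) (sym q∈I)
  ...     | no ¬sa = trans (toggle-adds (toggle-removes q∈I ¬sa) ab) (sym q∈I)
    where
    ab : AllBelow q (toggle q I)
    ab x x≺q = trans (toggle-≢ q I (≺⇒≢ x≺q)) (ideal-≺ ideal x≺q q∈I)
  toggle-involutive p {I} ideal q | yes refl | inj₂ q∉I with allBelow? q I
  ...     | yes ab = trans (toggle-removes (toggle-adds q∉I ab) ¬sa) (sym q∉I)
    where
    ¬sa : ¬ SomeAbove q (toggle q I)
    ¬sa sa with x , q≺x , x∈I ← Equivalence.to (someAbove-toggle-self q I) sa
      with () ← trans (sym q∉I) (ideal-≺ ideal q≺x x∈I)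
  ...     | no ¬ab = trans (toggle-keeps-out (toggle-keeps-out q∉I ¬ab)
                              (¬ab ∘ Equivalence.to (allBelow-toggle-self q I))) (sym q∉I)

  NonAdjacent : Fin m → Fin m → Set
  NonAdjacent p q = ¬ Covers _≼_ p q × ¬ Covers _≼_ q p

  NonAdjacent-sym : ∀ {p q} → NonAdjacent p q → NonAdjacent q p
  NonAdjacent-sym (¬pq , ¬qp) = ¬qp , ¬pq

  ≺-between : ∀ {q p} → q ≺ p → ¬ Covers _≼_ p q → ∃ λ c → q ≺ c × c ≺ p
  ≺-between {q} {p} q≺p ¬cover with any? (λ c → (q ≺? c) ×-dec (c ≺? p))
  ... | yes between = between
  ... | no ¬between = ⊥-elim (¬cover (q≺p , λ c q≺c≺p → ¬between (c , q≺c≺p)))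

  allBelow-toggle : ∀ {p q I} → IsIdeal I → ¬ Covers _≼_ p q →
    AllBelow p (toggle q I) ⇔ AllBelow p I
  allBelow-toggle {p} {q} {I} ideal ¬cover with q ≺? p
  ... | no q⊀p = allBelow-⇔ (λ x x≺p → toggle-≢ q I λ { refl → q⊀p x≺p })
  ... | yes q≺p with mid , q≺mid , mid≺p ← ≺-between q≺p ¬cover = mk⇔ to from
    where
    mid≢q = ≺⇒≢ q≺mid ∘ sym
    to : AllBelow p (toggle q I) → AllBelow p I
    to ab x x≺p with x ≟ q
    ... | no x≢q = trans (sym (toggle-≢ q I x≢q)) (ab x x≺p)
    ... | yes refl = ideal-≺ ideal q≺mid (trans (sym (toggle-≢ x I mid≢q)) (ab mid mid≺p))
    from : AllBelow p I → AllBelow p (toggle q I)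
    from ab x x≺p with x ≟ q
    ... | no x≢q = trans (toggle-≢ q I x≢q) (ab x x≺p)
    ... | yes refl = toggle-keeps {I = I} (ab x x≺p) (mid , q≺mid , ab mid mid≺p)

  someAbove-toggle : ∀ {p q I} → IsIdeal I → ¬ Covers _≼_ q p →
    SomeAbove p (toggle q I) ⇔ SomeAbove p I
  someAbove-toggle {p} {q} {I} ideal ¬cover with p ≺? q
  ... | no p⊀q = someAbove-⇔ (λ x p≺x → toggle-≢ q I λ { refl → p⊀q p≺x })
  ... | yes p≺q with mid , p≺mid , mid≺q ← ≺-between p≺q ¬cover = mk⇔ to from
    where
    to : SomeAbove p (toggle q I) → SomeAbove p I
    to (x , p≺x , x∈) with x ≟ q
    ... | no x≢q = x , p≺x , trans (sym (toggle-≢ q I x≢q)) x∈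
    ... | yes refl with ∈-or-∉ I x | allBelow? x I
    ...   | inj₁ x∈I | _ = x , p≺x , x∈I
    ...   | inj₂ _ | yes ab = mid , p≺mid , ab mid mid≺q
    ...   | inj₂ x∉I | no ¬ab with () ← trans (sym x∈) (toggle-keeps-out x∉I ¬ab)
    from : SomeAbove p I → SomeAbove p (toggle q I)
    from (x , p≺x , x∈I) with x ≟ q
    ... | no x≢q = x , p≺x , trans (toggle-≢ q I x≢q) x∈I
    ... | yes refl = mid , p≺mid , trans (toggle-≢ x I (≺⇒≢ mid≺q)) (ideal-≺ ideal mid≺q x∈I)

  toggle-self-toggle-≢ : ∀ {p q I} → IsIdeal I → p ≢ q → NonAdjacent p q →
    toggle p (toggle q I) p ≡ toggle p I p
  toggle-self-toggle-≢ {p} {q} {I} ideal p≢q (¬pq , ¬qp) =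
    toggle-self-cong p (toggle-≢ q I p≢q) (allBelow-toggle ideal ¬pq) (someAbove-toggle ideal ¬qp)

  toggle-comm : ∀ {p q I} → IsIdeal I → NonAdjacent p q →
    toggle p (toggle q I) ≗ toggle q (toggle p I)
  toggle-comm {p} {q} {I} ideal nonAdj x with p ≟ q
  ... | yes refl = refl
  ... | no p≢q with x ≟ p | x ≟ q
  ...   | yes refl | _ =
    trans (toggle-self-toggle-≢ ideal p≢q nonAdj) (sym (toggle-≢ q (toggle x I) p≢q))
  ...   | no x≢p | yes refl = trans (toggle-≢ p (toggle x I) x≢p)
    (sym (toggle-self-toggle-≢ ideal (p≢q ∘ sym) (NonAdjacent-sym nonAdj)))
  ...   | no x≢p | no x≢q = begin
    toggle p (toggle q I) x ≡⟨ toggle-≢ p (toggle q I) x≢p ⟩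
    toggle q I x            ≡⟨ toggle-≢ q I x≢q ⟩
    I x                     ≡⟨ toggle-≢ p I x≢p ⟨
    toggle p I x            ≡⟨ toggle-≢ q (toggle p I) x≢q ⟨
    toggle q (toggle p I) x ∎
    where open ≡-Reasoning

  -- Words of toggles

  Word : Set
  Word = List (Fin m)

  toggles : Word → Subset → Subset
  toggles [] I = I
  toggles (p ∷ w) I = toggle p (toggles w I)

  toggles-++ : ∀ u v I → toggles (u ++ v) I ≡ toggles u (toggles v I)
  toggles-++ [] v I = refl
  toggles-++ (p ∷ u) v I = cong (toggle p) (toggles-++ u v I)

  toggles-ideal : ∀ w {I} → IsIdeal I → IsIdeal (toggles w I)
  toggles-ideal [] ideal = ideal
  toggles-ideal (p ∷ w) ideal = toggle-ideal p (toggles-ideal w ideal)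

  toggles-cong : ∀ w {I J} → I ≗ J → toggles w I ≗ toggles w J
  toggles-cong [] I≗J = I≗J
  toggles-cong (p ∷ w) I≗J = toggle-cong p (toggles-cong w I≗J)

  -- Toggles are involutive and commute only on order ideals, so words are compared there.
  infix 4 _≈ʷ_
  record _≈ʷ_ (u v : Word) : Set where
    constructor on-ideals
    field toggles-≗ : ∀ I → IsIdeal I → toggles u I ≗ toggles v I
  open _≈ʷ_ public

  ≈ʷ-setoid : Setoid 0ℓ 0ℓ
  ≈ʷ-setoid = record
    { Carrier = Word
    ; _≈_ = _≈ʷ_
    ; isEquivalence = record
      { refl = on-ideals λ I _ q → refl
      ; sym = λ u≈v → on-ideals λ I ideal q → sym (toggles-≗ u≈v I ideal q)
      ; trans = λ u≈v v≈w → on-ideals λ I ideal q →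
          trans (toggles-≗ u≈v I ideal q) (toggles-≗ v≈w I ideal q)
      }
    }

  open Setoid ≈ʷ-setoid public using ()
    renaming (refl to ≈ʷ-refl; reflexive to ≈ʷ-reflexive; sym to ≈ʷ-sym; trans to ≈ʷ-trans)

  ++-cong : ∀ {u u′ v v′} → u ≈ʷ u′ → v ≈ʷ v′ → u ++ v ≈ʷ u′ ++ v′
  ++-cong {u} {u′} {v} {v′} u≈u′ v≈v′ = on-ideals λ I ideal q → let open ≡-Reasoning in begin
    toggles (u ++ v) I q      ≡⟨ cong (_$ q) (toggles-++ u v I) ⟩
    toggles u (toggles v I) q  ≡⟨ toggles-cong u (toggles-≗ v≈v′ I ideal) q ⟩
    toggles u (toggles v′ I) q ≡⟨ toggles-≗ u≈u′ (toggles v′ I) (toggles-ideal v′ ideal) q ⟩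
    toggles u′ (toggles v′ I) q ≡⟨ cong (_$ q) (toggles-++ u′ v′ I) ⟨
    toggles (u′ ++ v′) I q     ∎

  ++-congˡ : ∀ w {u v} → u ≈ʷ v → w ++ u ≈ʷ w ++ v
  ++-congˡ w = ++-cong {w} ≈ʷ-refl

  ++-congʳ : ∀ w {u v} → u ≈ʷ v → u ++ w ≈ʷ v ++ w
  ++-congʳ w u≈v = ++-cong {v = w} u≈v ≈ʷ-refl

  toggle-twice : ∀ p → p ∷ p ∷ [] ≈ʷ []
  toggle-twice p = on-ideals λ I ideal → toggle-involutive p ideal

  reverse-++-cancel : ∀ w → reverse w ++ w ≈ʷ []
  reverse-++-cancel [] = ≈ʷ-refl
  reverse-++-cancel (p ∷ w) = begin
    reverse (p ∷ w) ++ p ∷ w         ≡⟨ cong (_++ p ∷ w) (unfold-reverse p w) ⟩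
    (reverse w ++ [ p ]) ++ p ∷ w     ≡⟨ ++-assoc (reverse w) [ p ] (p ∷ w) ⟩
    reverse w ++ (p ∷ p ∷ []) ++ w    ≈⟨ ++-congˡ (reverse w) (++-congʳ w (toggle-twice p)) ⟩
    reverse w ++ w                    ≈⟨ reverse-++-cancel w ⟩
    []                                ∎
    where open SetoidReasoning ≈ʷ-setoid

  ++-reverse-cancel : ∀ w → w ++ reverse w ≈ʷ []
  ++-reverse-cancel w =
    subst (λ w′ → w′ ++ reverse w ≈ʷ []) (reverse-involutive w) (reverse-++-cancel (reverse w))

  Commuting : Word → Word → Set
  Commuting u v = ∀ {x y} → x ∈ u → y ∈ v → NonAdjacent x y

  Commuting-sym : ∀ {u v} → Commuting u v → Commuting v u
  Commuting-sym u↔v y∈v x∈u = NonAdjacent-sym (u↔v x∈u y∈v)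

  swap : ∀ {p q} → NonAdjacent p q → p ∷ q ∷ [] ≈ʷ q ∷ p ∷ []
  swap nonAdj = on-ideals λ I ideal → toggle-comm ideal nonAdj

  commute-single : ∀ p v → Commuting [ p ] v → p ∷ v ≈ʷ v ++ [ p ]
  commute-single p [] _ = ≈ʷ-refl
  commute-single p (q ∷ v) p↔v = begin
    (p ∷ q ∷ []) ++ v  ≈⟨ ++-congʳ v (swap (p↔v (here refl) (here refl))) ⟩
    [ q ] ++ p ∷ v     ≈⟨ ++-congˡ [ q ] (commute-single p v λ p∈ y∈ → p↔v p∈ (there y∈)) ⟩
    q ∷ v ++ [ p ]     ∎
    where open SetoidReasoning ≈ʷ-setoid

  commute : ∀ u v → Commuting u v → u ++ v ≈ʷ v ++ u
  commute [] v _ = ≈ʷ-reflexive (sym (++-identityʳ v))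
  commute (p ∷ u) v pu↔v = begin
    [ p ] ++ u ++ v     ≈⟨ ++-congˡ [ p ] (commute u v λ x∈ y∈ → pu↔v (there x∈) y∈) ⟩
    (p ∷ v) ++ u
      ≈⟨ ++-congʳ u (commute-single p v λ { (here refl) y∈ → pu↔v (here refl) y∈ }) ⟩
    (v ++ [ p ]) ++ u   ≡⟨ ++-assoc v [ p ] u ⟩
    v ++ p ∷ u          ∎
    where open SetoidReasoning ≈ʷ-setoid

  filter-∪ : ∀ {P Q : Pred (Fin m) 0ℓ} (P? : Decidable P) (Q? : Decidable Q) l →
    (∀ {x} → P x → ¬ Q x) → (∀ {x y} → P x → Q y → NonAdjacent x y) →
    filter P? l ++ filter Q? l ≈ʷ filter (P? ∪? Q?) l
  filter-∪ P? Q? [] disjoint P↔Q = ≈ʷ-refl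
  filter-∪ P? Q? (x ∷ l) disjoint P↔Q with P? x | Q? x
  ... | yes Px | yes Qx = ⊥-elim (disjoint Px Qx)
  ... | yes Px | no _ = ++-congˡ [ x ] (filter-∪ P? Q? l disjoint P↔Q)
  ... | no _ | no _ = filter-∪ P? Q? l disjoint P↔Q
  ... | no _ | yes Qx = begin
    fP ++ x ∷ fQ      ≡⟨ ++-assoc fP [ x ] fQ ⟨
    (fP ++ [ x ]) ++ fQ ≈⟨ ++-congʳ fQ (commute fP [ x ] fP↔x) ⟩
    x ∷ fP ++ fQ      ≈⟨ ++-congˡ [ x ] (filter-∪ P? Q? l disjoint P↔Q) ⟩
    x ∷ filter (P? ∪? Q?) l ∎
    where
    fP = filter P? l
    fQ = filter Q? l
    fP↔x : Commuting fP [ x ]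
    fP↔x y∈ (here refl) = P↔Q (proj₂ (∈-filter⁻ P? {xs = l} y∈)) Qx
    open SetoidReasoning ≈ʷ-setoid

  -- Conjugacy

  Conjugates : Word → Word → Word → Set
  Conjugates φ u v = φ ++ u ≈ʷ v ++ φ

  conj-trans : ∀ φ ψ {u v w} → Conjugates φ u v → Conjugates ψ v w → Conjugates (ψ ++ φ) u w
  conj-trans φ ψ {u} {v} {w} φuv ψvw = begin
    (ψ ++ φ) ++ u  ≡⟨ ++-assoc ψ φ u ⟩
    ψ ++ φ ++ u    ≈⟨ ++-congˡ ψ φuv ⟩
    ψ ++ v ++ φ    ≡⟨ ++-assoc ψ v φ ⟨
    (ψ ++ v) ++ φ  ≈⟨ ++-congʳ φ ψvw ⟩
    (w ++ ψ) ++ φ  ≡⟨ ++-assoc w ψ φ ⟩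
    w ++ ψ ++ φ    ∎
    where open SetoidReasoning ≈ʷ-setoid

  conj-sym : ∀ φ {u v} → Conjugates φ u v → Conjugates (reverse φ) v u
  conj-sym φ {u} {v} φuv = begin
    φ⁻ ++ v                   ≡⟨ ++-identityʳ (φ⁻ ++ v) ⟨
    (φ⁻ ++ v) ++ []           ≈⟨ ++-congˡ (φ⁻ ++ v) (++-reverse-cancel φ) ⟨
    (φ⁻ ++ v) ++ φ ++ φ⁻      ≡⟨ ++-assoc φ⁻ v (φ ++ φ⁻) ⟩
    φ⁻ ++ v ++ φ ++ φ⁻        ≡⟨ cong (φ⁻ ++_) (++-assoc v φ φ⁻) ⟨
    φ⁻ ++ (v ++ φ) ++ φ⁻      ≈⟨ ++-congˡ φ⁻ (++-congʳ φ⁻ φuv) ⟨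
    φ⁻ ++ (φ ++ u) ++ φ⁻      ≡⟨ cong (φ⁻ ++_) (++-assoc φ u φ⁻) ⟩
    φ⁻ ++ φ ++ u ++ φ⁻        ≡⟨ ++-assoc φ⁻ φ (u ++ φ⁻) ⟨
    (φ⁻ ++ φ) ++ u ++ φ⁻      ≈⟨ ++-congʳ (u ++ φ⁻) (reverse-++-cancel φ) ⟩
    u ++ φ⁻                   ∎
    where
    φ⁻ = reverse φ
    open SetoidReasoning ≈ʷ-setoid

  conj-resp-≈ʷ : ∀ φ {u u′ v v′} → u′ ≈ʷ u → v ≈ʷ v′ → Conjugates φ u v → Conjugates φ u′ v′
  conj-resp-≈ʷ φ u′≈u v≈v′ φuv =
    ≈ʷ-trans (++-congˡ φ u′≈u) (≈ʷ-trans φuv (++-congʳ φ v≈v′))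

  conj-rotate : ∀ u v → Conjugates v (u ++ v) (v ++ u)
  conj-rotate u v = ≈ʷ-reflexive (sym (++-assoc v u v))

  conj-rotate⁻¹ : ∀ u v → Conjugates (reverse u) (u ++ v) (v ++ u)
  conj-rotate⁻¹ u v = conj-sym u (conj-rotate v u)

  conj-prefix : ∀ φ g {u v} → Commuting φ g → Conjugates φ u v → Conjugates φ (g ++ u) (g ++ v)
  conj-prefix φ g {u} {v} φ↔g φuv = begin
    φ ++ g ++ u    ≡⟨ ++-assoc φ g u ⟨
    (φ ++ g) ++ u  ≈⟨ ++-congʳ u (commute φ g φ↔g) ⟩
    (g ++ φ) ++ u  ≡⟨ ++-assoc g φ u ⟩
    g ++ φ ++ u    ≈⟨ ++-congˡ g φuv ⟩
    g ++ v ++ φ    ≡⟨ ++-assoc g v φ ⟨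
    (g ++ v) ++ φ  ∎
    where open SetoidReasoning ≈ʷ-setoid

  conj-suffix : ∀ φ g {u v} → Commuting φ g → Conjugates φ u v → Conjugates φ (u ++ g) (v ++ g)
  conj-suffix φ g {u} {v} φ↔g φuv = begin
    φ ++ u ++ g    ≡⟨ ++-assoc φ u g ⟨
    (φ ++ u) ++ g  ≈⟨ ++-congʳ g φuv ⟩
    (v ++ φ) ++ g  ≡⟨ ++-assoc v φ g ⟩
    v ++ φ ++ g    ≈⟨ ++-congˡ v (commute φ g φ↔g) ⟩
    v ++ g ++ φ    ≡⟨ ++-assoc v g φ ⟨
    (v ++ g) ++ φ  ∎
    where open SetoidReasoning ≈ʷ-setoid

  conj-insert : ∀ φ g {u v u′ v′} → Commuting φ g → Conjugates φ u v →
    (u′ ≈ʷ g ++ u) ⊎ (u′ ≈ʷ u ++ g) → (v′ ≈ʷ g ++ v) ⊎ (v′ ≈ʷ v ++ g) →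
    ∃ λ ψ → ψ ⊆ v ++ φ × Conjugates ψ u′ v′
  conj-insert φ g {u} {v} φ↔g φuv (inj₁ u′≈) (inj₁ v′≈) =
    φ , xs⊆ys++xs φ v , conj-resp-≈ʷ φ u′≈ (≈ʷ-sym v′≈) (conj-prefix φ g φ↔g φuv)
  conj-insert φ g {u} {v} φ↔g φuv (inj₂ u′≈) (inj₂ v′≈) =
    φ , xs⊆ys++xs φ v , conj-resp-≈ʷ φ u′≈ (≈ʷ-sym v′≈) (conj-suffix φ g φ↔g φuv)
  conj-insert φ g {u} {v} φ↔g φuv (inj₁ u′≈) (inj₂ v′≈) =
    v ++ φ , ⊆-refl , conj-resp-≈ʷ (v ++ φ) u′≈ (≈ʷ-sym v′≈)
      (conj-trans φ v (conj-prefix φ g φ↔g φuv) (conj-rotate g v))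
  conj-insert φ g {u} {v} φ↔g φuv (inj₂ u′≈) (inj₁ v′≈) =
    reverse v ++ φ , reverse-++⊆ , conj-resp-≈ʷ (reverse v ++ φ) u′≈ (≈ʷ-sym v′≈)
      (conj-trans φ (reverse v) (conj-suffix φ g φ↔g φuv) (conj-rotate⁻¹ v g))
    where
    reverse-++⊆ : reverse v ++ φ ⊆ v ++ φ
    reverse-++⊆ x∈ with ∈-++⁻ (reverse v) x∈
    ... | inj₁ x∈v⁻ = ∈-++⁺ˡ (AnyP.reverse⁻ {xs = v} x∈v⁻)
    ... | inj₂ x∈φ = ∈-++⁺ʳ v x∈φ

  conj-toggles : ∀ φ {u v} → Conjugates φ u v →
    ∀ I → IsIdeal I → toggles φ (toggles u I) ≗ toggles v (toggles φ I)
  conj-toggles φ {u} {v} φuv I ideal q = begin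
    toggles φ (toggles u I) q  ≡⟨ cong (_$ q) (toggles-++ φ u I) ⟨
    toggles (φ ++ u) I q       ≡⟨ toggles-≗ φuv I ideal q ⟩
    toggles (v ++ φ) I q       ≡⟨ cong (_$ q) (toggles-++ v φ I) ⟩
    toggles v (toggles φ I) q  ∎
    where open ≡-Reasoning

  toggles-reverse-cancel : ∀ w {I} → IsIdeal I → toggles (reverse w) (toggles w I) ≗ I
  toggles-reverse-cancel w {I} ideal q =
    trans (cong (_$ q) (sym (toggles-++ (reverse w) w I))) (toggles-≗ (reverse-++-cancel w) I ideal q)

  toggles-cancel-reverse : ∀ w {I} → IsIdeal I → toggles w (toggles (reverse w) I) ≗ I
  toggles-cancel-reverse w {I} ideal q =
    trans (cong (_$ q) (sym (toggles-++ w (reverse w) I))) (toggles-≗ (++-reverse-cancel w) I ideal q)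

  toggles-bijection : ∀ w → IsBijectionOnJ (toggles w)
  toggles-bijection w =
      (λ I ideal → toggles-ideal w ideal)
    , (λ I I′ ideal ideal′ same q → begin
        I q                                   ≡⟨ toggles-reverse-cancel w ideal q ⟨
        toggles (reverse w) (toggles w I) q   ≡⟨ toggles-cong (reverse w) same q ⟩
        toggles (reverse w) (toggles w I′) q  ≡⟨ toggles-reverse-cancel w ideal′ q ⟩
        I′ q                                  ∎)
    , (λ I′ ideal′ → toggles (reverse w) I′ , toggles-ideal (reverse w) ideal′
                   , toggles-cancel-reverse w ideal′)
    where open ≡-Reasoning

  toggleAll-filter : ∀ {P : Pred (Fin m) 0ℓ} (P? : Decidable P) I →
    toggleAll (does ∘ P?) I ≡ toggles (filter P? (allFin m)) I
  toggleAll-filter P? I = go (allFin m)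
    where
    go : ∀ l → foldr (λ p f → if does (P? p) then toggle p ∘ f else f) id l I
             ≡ toggles (filter P? l) I
    go [] = refl
    go (p ∷ l) with does (P? p)
    ... | true = cong (toggle p) (go l)
    ... | false = go l

  foldr-toggles : ∀ {A : Set} (op : A → Subset → Subset) (word : A → Word) →
    (∀ a I → op a I ≗ toggles (word a) I) →
    ∀ l I → foldr (λ a f → op a ∘ f) id l I ≗ toggles (concatMap word l) I
  foldr-toggles op word op≗ [] I q = refl
  foldr-toggles op word op≗ (a ∷ l) I q = begin
    op a (foldr (λ a f → op a ∘ f) id l I) q         ≡⟨ op≗ a _ q ⟩
    toggles (word a) (foldr (λ a f → op a ∘ f) id l I) q
      ≡⟨ toggles-cong (word a) (foldr-toggles op word op≗ l I) q ⟩
    toggles (word a) (toggles (concatMap word l) I) q ≡⟨ cong (_$ q) (toggles-++ (word a) _ I) ⟨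
    toggles (concatMap word (a ∷ l)) I q             ∎
    where open ≡-Reasoning

  foldr-oneLine : ∀ {K} (op : Fin K → Subset → Subset) (word : ℕ → Word) →
    (∀ i I → op i I ≡ toggles (word (toℕ i)) I) → ∀ (ν : Permutation′ K) I →
    foldr (λ i f → op (ν ⟨$⟩ʳ i) ∘ f) id (allFin K) I ≗ toggles (concatMap word (oneLine ν)) I
  foldr-oneLine {K} op word op≡ ν I q = trans
    (foldr-toggles (op ∘ (ν ⟨$⟩ʳ_)) (word ∘ toℕ ∘ (ν ⟨$⟩ʳ_))
                   (λ i I q → cong (_$ q) (op≡ (ν ⟨$⟩ʳ i) I)) (allFin K) I q)
    (cong (λ w → toggles w I q) (sym (concatMap-map word (toℕ ∘ (ν ⟨$⟩ʳ_)) (allFin K))))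

  module Graded (idx : Fin m → ℕ)
                (covers-adjacent : ∀ {p q} → Covers _≼_ p q → Adjacent (idx p) (idx q)) where

    AtLevel : ℕ → Pred (Fin m) 0ℓ
    AtLevel j p = idx p ≡ j

    BelowOfParity : Parity → ℕ → Pred (Fin m) 0ℓ
    BelowOfParity b j p = idx p ℕ.< j × parity (idx p) ≡ b

    atLevel? : ∀ j → Decidable (AtLevel j)
    atLevel? j p = idx p ℕ.≟ j

    belowOfParity? : ∀ b j → Decidable (BelowOfParity b j)
    belowOfParity? b j p = (idx p ℕ.<? j) ×-dec (parity (idx p) ℙ.≟ b)

    level : ℕ → Word
    level j = filter (atLevel? j) (allFin m)

    ∈-level : ∀ {j x} → x ∈ level j → idx x ≡ j
    ∈-level {j} = proj₂ ∘ ∈-filter⁻ (atLevel? j) {xs = allFin m}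

    levels : List ℕ → Word
    levels = concatMap level

    ∈-levels : ∀ L {x} → x ∈ levels L → idx x ∈ L
    ∈-levels (a ∷ L) x∈ with ∈-++⁻ (level a) x∈
    ... | inj₁ x∈a = here (∈-level x∈a)
    ... | inj₂ x∈L = there (∈-levels L x∈L)

    nonAdjacent : ∀ {x y} → ¬ Adjacent (idx x) (idx y) → NonAdjacent x y
    nonAdjacent far = far ∘ covers-adjacent , far ∘ Adjacent-sym ∘ covers-adjacent

    commuting-by-idx : ∀ {u v} → (∀ {x y} → x ∈ u → y ∈ v → ¬ Adjacent (idx x) (idx y)) →
      Commuting u v
    commuting-by-idx far x∈ y∈ = nonAdjacent (far x∈ y∈)

    belowOfParity : Parity → ℕ → Word
    belowOfParity b j = filter (belowOfParity? b j) (allFin m)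

    canonical : ℕ → Word
    canonical j = belowOfParity 0ℙ j ++ belowOfParity 1ℙ j

    ∈-belowOfParity : ∀ {b j x} → x ∈ belowOfParity b j → BelowOfParity b j x
    ∈-belowOfParity {b} {j} = proj₂ ∘ ∈-filter⁻ (belowOfParity? b j) {xs = allFin m}

    ∈-canonical : ∀ j {x} → x ∈ canonical j → idx x ℕ.< j
    ∈-canonical j x∈ with ∈-++⁻ (belowOfParity 0ℙ j) x∈
    ... | inj₁ x∈₀ = proj₁ (∈-belowOfParity x∈₀)
    ... | inj₂ x∈₁ = proj₁ (∈-belowOfParity x∈₁)

    canonical-zero : canonical 0 ≡ []
    canonical-zero = cong₂ _++_ (none 0ℙ) (none 1ℙ)
      where
      none : ∀ b → belowOfParity b 0 ≡ []
      none b = filter-none (belowOfParity? b 0)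
                 (All.universal (λ p → ℕP.n≮0 ∘ proj₁) (allFin m))

    far-from-below : ∀ {b j x y} → parity j ≡ b → AtLevel j x → BelowOfParity b j y →
      ¬ Adjacent (idx x) (idx y)
    far-from-below {x = x} {y} parity-j refl (y<j , parity-y) (inj₁ x≡1+y) =
      parity-suc-≢ (idx y) (trans (cong parity (sym x≡1+y)) (trans parity-j (sym parity-y)))
    far-from-below {x = x} {y} parity-j refl (y<j , parity-y) (inj₂ y≡1+x) =
      ℕP.<-asym y<j (subst (idx x ℕ.<_) (sym y≡1+x) (ℕP.n<1+n (idx x)))

    level-below-commuting : ∀ {b j} → parity j ≡ b → Commuting (level j) (belowOfParity b j)
    level-below-commuting parity-j =
      commuting-by-idx λ x∈ y∈ → far-from-below parity-j (∈-level x∈) (∈-belowOfParity y∈)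

    belowOfParity-suc-≡ : ∀ {b j} → parity j ≡ b →
      belowOfParity b (suc j) ≈ʷ level j ++ belowOfParity b j
    belowOfParity-suc-≡ {b} {j} parity-j = ≈ʷ-sym (begin
      level j ++ belowOfParity b j
        ≈⟨ filter-∪ (atLevel? j) (belowOfParity? b j) (allFin m) disjoint
                    (λ x-at y-below → nonAdjacent (far-from-below parity-j x-at y-below)) ⟩
      filter (atLevel? j ∪? belowOfParity? b j) (allFin m)
        ≡⟨ filter-≐ (atLevel? j ∪? belowOfParity? b j) (belowOfParity? b (suc j))
                    (to , from) (allFin m) ⟩
      belowOfParity b (suc j) ∎)
      where
      open SetoidReasoning ≈ʷ-setoid
      disjoint : ∀ {x} → AtLevel j x → ¬ BelowOfParity b j x
      disjoint refl (x<x , _) = ℕP.<-irrefl refl x<x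
      to : AtLevel j ∪ BelowOfParity b j ⊆₁ BelowOfParity b (suc j)
      to (inj₁ refl) = ℕP.n<1+n j , parity-j
      to (inj₂ (x<j , parity-x)) = ℕP.m<n⇒m<1+n x<j , parity-x
      from : BelowOfParity b (suc j) ⊆₁ AtLevel j ∪ BelowOfParity b j
      from (x<1+j , parity-x) with ℕP.m<1+n⇒m<n∨m≡n x<1+j
      ... | inj₁ x<j = inj₂ (x<j , parity-x)
      ... | inj₂ x≡j = inj₁ x≡j

    belowOfParity-suc-≢ : ∀ {b j} → parity j ≢ b → belowOfParity b (suc j) ≡ belowOfParity b j
    belowOfParity-suc-≢ {b} {j} parity-j≢b =
      filter-≐ (belowOfParity? b (suc j)) (belowOfParity? b j) (to , from) (allFin m)
      where
      to : BelowOfParity b (suc j) ⊆₁ BelowOfParity b j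
      to (x<1+j , parity-x) with ℕP.m<1+n⇒m<n∨m≡n x<1+j
      ... | inj₁ x<j = x<j , parity-x
      ... | inj₂ refl = ⊥-elim (parity-j≢b parity-x)
      from : BelowOfParity b j ⊆₁ BelowOfParity b (suc j)
      from (x<j , parity-x) = ℕP.m<n⇒m<1+n x<j , parity-x

    canonical-suc : ∀ j → canonical (suc j) ≈ʷ level j ++ canonical j
                        ⊎ canonical (suc j) ≈ʷ canonical j ++ level j
    canonical-suc j with parity j in parity-j
    ... | 0ℙ = inj₁ (begin
      belowOfParity 0ℙ (suc j) ++ belowOfParity 1ℙ (suc j)
        ≈⟨ ++-cong (belowOfParity-suc-≡ parity-j)
                   (≈ʷ-reflexive (belowOfParity-suc-≢ ((λ ()) ∘ trans (sym parity-j)))) ⟩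
      (level j ++ belowOfParity 0ℙ j) ++ belowOfParity 1ℙ j
        ≡⟨ ++-assoc (level j) (belowOfParity 0ℙ j) (belowOfParity 1ℙ j) ⟩
      level j ++ canonical j ∎)
      where open SetoidReasoning ≈ʷ-setoid
    ... | 1ℙ = inj₂ (begin
      belowOfParity 0ℙ (suc j) ++ belowOfParity 1ℙ (suc j)
        ≈⟨ ++-cong (≈ʷ-reflexive (belowOfParity-suc-≢ ((λ ()) ∘ trans (sym parity-j))))
                   (belowOfParity-suc-≡ parity-j) ⟩
      belowOfParity 0ℙ j ++ level j ++ belowOfParity 1ℙ j
        ≈⟨ ++-congˡ (belowOfParity 0ℙ j)
             (commute (level j) (belowOfParity 1ℙ j) (level-below-commuting parity-j)) ⟩
      belowOfParity 0ℙ j ++ belowOfParity 1ℙ j ++ level j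
        ≡⟨ ++-assoc (belowOfParity 0ℙ j) (belowOfParity 1ℙ j) (level j) ⟨
      canonical j ++ level j ∎)
      where open SetoidReasoning ≈ʷ-setoid

    commuting-level : ∀ {φ j} → (∀ {x} → x ∈ φ → suc (idx x) ℕ.< j) → Commuting φ (level j)
    commuting-level φ-bound = commuting-by-idx λ x∈ y∈ →
      subst (λ i → ¬ Adjacent _ i) (sym (∈-level y∈)) (<-¬Adjacent (φ-bound x∈))

    levels-insert : ∀ j A B → Enumerates j (A ++ B) →
      levels (A ++ j ∷ B) ≈ʷ level j ++ levels (A ++ B)
      ⊎ levels (A ++ j ∷ B) ≈ʷ levels (A ++ B) ++ level j
    levels-insert j A B (u , ∈⇔<) with Any.any? (λ a → suc a ℕ.≟ j) A
    ... | no ¬adjacent∈A = inj₁ (begin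
      levels (A ++ j ∷ B)                ≡⟨ concatMap-++ level A (j ∷ B) ⟩
      levels A ++ level j ++ levels B    ≡⟨ ++-assoc (levels A) (level j) (levels B) ⟨
      (levels A ++ level j) ++ levels B  ≈⟨ ++-congʳ (levels B) (commute (levels A) (level j) A↔j) ⟩
      (level j ++ levels A) ++ levels B  ≡⟨ ++-assoc (level j) (levels A) (levels B) ⟩
      level j ++ levels A ++ levels B    ≡⟨ cong (level j ++_) (concatMap-++ level A B) ⟨
      level j ++ levels (A ++ B)         ∎)
      where
      open SetoidReasoning ≈ʷ-setoid
      A↔j : Commuting (levels A) (level j)
      A↔j = commuting-level λ x∈ →
        ℕP.≤∧≢⇒< (Equivalence.to (∈⇔< _) (∈-++⁺ˡ (∈-levels A x∈)))
                 (¬adjacent∈A ∘ lose (∈-levels A x∈))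
    ... | yes adjacent∈A with a , a∈A , 1+a≡j ← find adjacent∈A = inj₂ (begin
      levels (A ++ j ∷ B)                ≡⟨ concatMap-++ level A (j ∷ B) ⟩
      levels A ++ level j ++ levels B    ≈⟨ ++-congˡ (levels A) (commute (level j) (levels B) j↔B) ⟩
      levels A ++ levels B ++ level j    ≡⟨ ++-assoc (levels A) (levels B) (level j) ⟨
      (levels A ++ levels B) ++ level j  ≡⟨ cong (_++ level j) (concatMap-++ level A B) ⟨
      levels (A ++ B) ++ level j         ∎)
      where
      open SetoidReasoning ≈ʷ-setoid
      j↔B : Commuting (level j) (levels B)
      j↔B = Commuting-sym (commuting-level λ y∈ →
        ℕP.≤∧≢⇒< (Equivalence.to (∈⇔< _) (∈-++⁺ʳ A (∈-levels B y∈))) λ 1+y≡j →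
          Unique-++-disjoint A u a∈A
            (subst (_∈ B) (ℕP.suc-injective (trans 1+y≡j (sym 1+a≡j))) (∈-levels B y∈)))

    -- Induction on the top level j: it commutes with the part of L on the side of j not
    -- containing j - 1, and with canonical j on the side fixed by the parity of j; when the
    -- two sides differ, a rotation (itself a conjugation) moves it across.
    levels-conj-canonical : ∀ j L → Enumerates j L →
      ∃ λ φ → (∀ {x} → x ∈ φ → suc (idx x) ℕ.< j) × Conjugates φ (levels L) (canonical j)
    levels-conj-canonical zero [] _ =
      [] , (λ ()) , ≈ʷ-reflexive (sym (cong (_++ []) canonical-zero))
    levels-conj-canonical zero (a ∷ L) (_ , ∈⇔<) =
      ⊥-elim (ℕP.n≮0 (Equivalence.to (∈⇔< a) (here refl)))
    levels-conj-canonical (suc j) L enum@(_ , ∈⇔<)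
      with A , B , refl ← ∈-∃++ (Equivalence.from (∈⇔< j) (ℕP.n<1+n j))
      with enum′ ← Enumerates-dropMiddle j A B enum
      with φ , φ-bound , φ-conj ← levels-conj-canonical j (A ++ B) enum′
      with ψ , ψ⊆ , ψ-conj ← conj-insert φ (level j) (commuting-level φ-bound) φ-conj
                                (levels-insert j A B enum′) (canonical-suc j)
      = ψ , ψ-bound , ψ-conj
      where
      ψ-bound : ∀ {x} → x ∈ ψ → suc (idx x) ℕ.< suc j
      ψ-bound x∈ with ∈-++⁻ (canonical j) (ψ⊆ x∈)
      ... | inj₁ x∈canonical = ℕ.s≤s (∈-canonical j x∈canonical)
      ... | inj₂ x∈φ = ℕ.s≤s (ℕP.<⇒≤ (φ-bound x∈φ))

module RowColumn {m n k : ℕ} (R : RCPoset m n k) where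
  open RCPoset R hiding (_∈_)
  open ToggleGroup R

  colOffset rowOffset : Fin m → ℕ
  colOffset p = ∣ col p ℤ.- colBase ∣
  rowOffset p = ∣ row p ℤ.- rowBase ∣

  col-offset : ∀ p → colBase ℤ.+ + colOffset p ≡ col p
  col-offset p = offset-≡ (proj₁ (colRange p))

  row-offset : ∀ p → rowBase ℤ.+ + rowOffset p ≡ row p
  row-offset p = offset-≡ (proj₁ (rowRange p))

  colOffset<k : ∀ p → colOffset p ℕ.< k
  colOffset<k p =
    offset-< colBase (subst (ℤ._< colBase ℤ.+ + k) (sym (col-offset p)) (proj₂ (colRange p)))

  rowOffset<n : ∀ p → rowOffset p ℕ.< n
  rowOffset<n p =
    offset-< rowBase (subst (ℤ._< rowBase ℤ.+ + n) (sym (row-offset p)) (proj₂ (rowRange p)))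

  covers-adjacentᶜ : ∀ {p q} → Covers _≼_ p q → Adjacent (colOffset p) (colOffset q)
  covers-adjacentᶜ {p} {q} cover with coverStep p q cover
  ... | inj₁ π-q = inj₂ (offset-suc colBase (trans (col-offset q)
                     (trans (cong proj₁ π-q) (cong (ℤ._+ ℤ.1ℤ) (sym (col-offset p))))))
  ... | inj₂ π-q = inj₁ (offset-pred colBase (trans (col-offset q)
                     (trans (cong proj₁ π-q) (cong (ℤ._- ℤ.1ℤ) (sym (col-offset p))))))

  row-down-adjacent : ∀ {p q} → row q ≡ row p ℤ.- ℤ.1ℤ → Adjacent (rowOffset p) (rowOffset q)
  row-down-adjacent {p} {q} row-q = inj₁ (offset-pred rowBase
    (trans (row-offset q) (trans row-q (cong (ℤ._- ℤ.1ℤ) (sym (row-offset p))))))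

  covers-adjacentʳ : ∀ {p q} → Covers _≼_ p q → Adjacent (rowOffset p) (rowOffset q)
  covers-adjacentʳ {p} {q} cover with coverStep p q cover
  ... | inj₁ π-q = row-down-adjacent (cong proj₂ π-q)
  ... | inj₂ π-q = row-down-adjacent (cong proj₂ π-q)

  module Cols = Graded colOffset covers-adjacentᶜ
  module Rows = Graded rowOffset covers-adjacentʳ

  toggleAll-offset : ∀ (coord : Fin m → ℤ) base (offset : Fin m → ℕ) →
    (∀ p → base ℤ.+ + offset p ≡ coord p) → ∀ x I →
    toggleAll (λ p → does (coord p ℤ.≟ base ℤ.+ + x)) I
      ≡ toggles (filter (λ p → offset p ℕ.≟ x) (allFin m)) I
  toggleAll-offset coord base offset base+offset x I = trans (toggleAll-filter at-coord I)
    (cong (λ w → toggles w I) (filter-≐ at-coord (λ p → offset p ℕ.≟ x) (to , from) (allFin m)))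
    where
    at-coord = λ p → coord p ℤ.≟ base ℤ.+ + x
    to : ∀ {p} → coord p ≡ base ℤ.+ + x → offset p ≡ x
    to {p} coord-p = ℤP.+-injective (ℤ+-cancelˡ base (trans (base+offset p) coord-p))
    from : ∀ {p} → offset p ≡ x → coord p ≡ base ℤ.+ + x
    from {p} offset-p = trans (sym (base+offset p)) (cong (λ y → base ℤ.+ + y) offset-p)

  c-level : ∀ i I → c i I ≡ toggles (Cols.level (toℕ i)) I
  c-level i = toggleAll-offset col colBase colOffset col-offset (toℕ i)

  r-level : ∀ j I → r j I ≡ toggles (Rows.level (toℕ j)) I
  r-level j = toggleAll-offset row rowBase rowOffset row-offset (toℕ j)

  pro-levels : ∀ ν I → pro ν I ≗ toggles (Cols.levels (oneLine ν)) I
  pro-levels = foldr-oneLine c Cols.level c-level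

  rowmotion-levels : ∀ ω I → rowmotion ω I ≗ toggles (Rows.levels (oneLine ω)) I
  rowmotion-levels = foldr-oneLine r Rows.level r-level

  baseParity : Parity
  baseParity = parityℤ (rowBase ℤ.- colBase)

  parity-colOffset : ∀ p → parity (colOffset p) ≡ parity (rowOffset p) ℙ.+ baseParity
  parity-colOffset p = begin
    parityℤ (+ colOffset p)
      ≡⟨ cong parityℤ (trans (regroup colBase rowBase (+ colOffset p) (+ rowOffset p))
                             (cong (ℤ._+ shift) (cong₂ ℤ._-_ (col-offset p) (row-offset p)))) ⟩
    parityℤ ((col p ℤ.- row p) ℤ.+ shift)
      ≡⟨ parityℤ-+ (col p ℤ.- row p) shift ⟩
    parityℤ (col p ℤ.- row p) ℙ.+ parityℤ shift
      ≡⟨ cong (ℙ._+ parityℤ shift) (parityℤ-even {col p ℤ.- row p} (π∈Π p)) ⟩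
    parityℤ shift
      ≡⟨ parityℤ-+ (+ rowOffset p) (rowBase ℤ.- colBase) ⟩
    parity (rowOffset p) ℙ.+ baseParity ∎
    where
    open ≡-Reasoning
    shift = + rowOffset p ℤ.+ (rowBase ℤ.- colBase)
    regroup : ∀ cb rb x y → x ≡ ((cb ℤ.+ x) ℤ.- (rb ℤ.+ y)) ℤ.+ (y ℤ.+ (rb ℤ.- cb))
    regroup = solve-∀

  belowOfParity-cols-rows : ∀ b →
    Cols.belowOfParity b k ≡ Rows.belowOfParity (b ℙ.+ baseParity) n
  belowOfParity-cols-rows b =
    filter-≐ (Cols.belowOfParity? b k) (Rows.belowOfParity? (b ℙ.+ baseParity) n) (to , from) (allFin m)
    where
    to : Cols.BelowOfParity b k ⊆₁ Rows.BelowOfParity (b ℙ.+ baseParity) n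
    to {p} (_ , parity-col) = rowOffset<n p , (begin
      parity (rowOffset p)                             ≡⟨ +-cancel-twice _ baseParity ⟨
      (parity (rowOffset p) ℙ.+ baseParity) ℙ.+ baseParity
        ≡⟨ cong (ℙ._+ baseParity) (trans (sym (parity-colOffset p)) parity-col) ⟩
      b ℙ.+ baseParity                                 ∎)
      where open ≡-Reasoning
    from : Rows.BelowOfParity (b ℙ.+ baseParity) n ⊆₁ Cols.BelowOfParity b k
    from {p} (_ , parity-row) = colOffset<k p , (begin
      parity (colOffset p)                      ≡⟨ parity-colOffset p ⟩
      parity (rowOffset p) ℙ.+ baseParity        ≡⟨ cong (ℙ._+ baseParity) parity-row ⟩
      (b ℙ.+ baseParity) ℙ.+ baseParity          ≡⟨ +-cancel-twice b baseParity ⟩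
      b                                         ∎)
      where open ≡-Reasoning

  canonical-cols-conj-rows : ∃ λ φ → Conjugates φ (Cols.canonical k) (Rows.canonical n)
  canonical-cols-conj-rows
    with baseParity | belowOfParity-cols-rows 0ℙ | belowOfParity-cols-rows 1ℙ
  ... | 0ℙ | below₀ | below₁ =
    [] , ≈ʷ-reflexive (trans (cong₂ _++_ below₀ below₁) (sym (++-identityʳ (Rows.canonical n))))
  ... | 1ℙ | below₀ | below₁ =
    Rows.belowOfParity 0ℙ n , conj-resp-≈ʷ (Rows.belowOfParity 0ℙ n)
      (≈ʷ-reflexive (cong₂ _++_ below₀ below₁)) ≈ʷ-refl
      (conj-rotate (Rows.belowOfParity 1ℙ n) (Rows.belowOfParity 0ℙ n))

  pro-conj-rowmotion : ∀ ω ν →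
    ∃ λ w → Conjugates w (Cols.levels (oneLine ν)) (Rows.levels (oneLine ω))
  pro-conj-rowmotion ω ν
    with φᶜ , _ , φᶜ-conj ← Cols.levels-conj-canonical k _ (oneLine-enumerates ν)
    with φʳ , _ , φʳ-conj ← Rows.levels-conj-canonical n _ (oneLine-enumerates ω)
    with ψ , ψ-conj ← canonical-cols-conj-rows
    = reverse φʳ ++ ψ ++ φᶜ
    , conj-trans (ψ ++ φᶜ) (reverse φʳ) (conj-trans φᶜ ψ φᶜ-conj ψ-conj) (conj-sym φʳ φʳ-conj)

theorem5p2 : ∀ {m n k} (R : RCPoset m n k) → let open RCPoset R in
    (ω : Permutation′ n) (ν : Permutation′ k) →
    ∃ λ (Φ : Subset → Subset) → IsBijectionOnJ Φ
    × (∀ I → IsIdeal I → ∀ p → Φ (pro ν I) p ≡ rowmotion ω (Φ I) p)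
theorem5p2 R ω ν with w , w-conj ← RowColumn.pro-conj-rowmotion R ω ν =
  toggles w , toggles-bijection w , λ I ideal p → begin
    toggles w (pro ν I) p                                ≡⟨ toggles-cong w (pro-levels ν I) p ⟩
    toggles w (toggles (Cols.levels (oneLine ν)) I) p ≡⟨ conj-toggles w w-conj I ideal p ⟩
    toggles (Rows.levels (oneLine ω)) (toggles w I) p ≡⟨ rowmotion-levels ω (toggles w I) p ⟨
    rowmotion ω (toggles w I) p                          ∎
  where
  open RCPoset R
  open ToggleGroup R
  open RowColumn R
  open ≡-Reasoning
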